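{- Let $r\in\mathbb{N}$, let $G$ be a graph with $\operatorname{col}_r(G)\le c$, and let $H$ be a graph with maximum degree at most $\Delta$. Then $\operatorname{col}_r(G\boxtimes H)<c(\Delta+2)^r$.
   Context: For a graph $G$, a linear ordering $\preceq$ of $V(G)$, a vertex $v$ and an integer $r\ge 1$, a vertex $x$ is $(r,\preceq)$-reachable from $v$ if there is a path $v=v_0,v_1,\dots,v_{r'}=x$ of length $r'\in\{0,1,\dots,r\}$ with $x\preceq v\prec v_i$ for all $i\in\{1,\dots,r'-1\}$. The (strong) $r$-colouring number $\operatorname{col}_r(G)$ is the minimum $k$ such that some linear ordering $\preceq$ of $V(G)$ has at most $k$ vertices $(r,\preceq)$-reachable from each vertex. The strong product $A\boxtimes B$ has vertex set $V(A)\times V(B)$, with distinct $(v,x),(w,y)$ adjacent iff ($v=w$ and $xy\in E(B)$) or ($x=y$ and $vw\in E(A)$) or ($vw\in E(A)$ and $xy\in E(B)$). -}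

module Defs where

open import Data.Nat using (ℕ; zero; suc; _≤_; _<_; _*_)
open import Data.Fin as F using (Fin; fromℕ; inject₁; remQuot)
open import Data.Fin.Permutation using (Permutation′; _⟨$⟩ʳ_)
open import Data.Product using (Σ; _×_; _,_; proj₁; proj₂)
import Data.Sum
open import Data.Sum using (_⊎_)
import Relation.Binary.PropositionalEquality
open import Data.List using (List; length)
open import Data.List.Relation.Unary.All using (All)
open import Data.List.Relation.Unary.Unique.Propositional using (Unique)
open import Relation.Binary.PropositionalEquality using (_≡_; _≢_)
open import Relation.Nullary using (¬_)
open import Function.Definitions using (Injective)

record Graph : Set₁ where
  field
    n     : ℕ
    Adj   : Fin n → Fin n → Set
    sym   : ∀ {u v} → Adj u v → Adj v u
    irrefl : ∀ {v} → ¬ Adj v v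
open Graph public

AtMost : {n : ℕ} → ℕ → (Fin n → Set) → Set
AtMost {n} k P = (xs : List (Fin n)) → Unique xs → All P xs → length xs ≤ k

MaxDegreeAtMost : Graph → ℕ → Set
MaxDegreeAtMost G Δ = ∀ v → AtMost Δ (Adj G v)

-- A linear ordering of V(G), given as a permutation: x ⪯ v iff rank x ≤ rank v.
Ordering : Graph → Set
Ordering G = Permutation′ (n G)

rank : (G : Graph) → Ordering G → Fin (n G) → Fin (n G)
rank G σ v = σ ⟨$⟩ʳ v

record Path (G : Graph) (r' : ℕ) : Set where
  field
    vtx  : Fin (suc r') → Fin (n G)
    inj  : Injective _≡_ _≡_ vtx
    step : (i : Fin r') → Adj G (vtx (inject₁ i)) (vtx (F.suc i))
open Path public

Reachable : (G : Graph) → Ordering G → ℕ → Fin (n G) → Fin (n G) → Set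
Reachable G σ r v x =
  Σ ℕ λ r' → r' ≤ r × Σ (Path G r') λ p →
    vtx p F.zero ≡ v × vtx p (fromℕ r') ≡ x ×
    rank G σ x F.≤ rank G σ v ×
    ((i : Fin (suc r')) → i ≢ F.zero → i ≢ fromℕ r' →
       rank G σ v F.< rank G σ (vtx p i))

ColAtMost : Graph → ℕ → ℕ → Set
ColAtMost G r k = Σ (Ordering G) λ σ → ∀ v → AtMost k (Reachable G σ r v)

-- Strong product; vertex set Fin (n A * n B) ≅ Fin (n A) × Fin (n B) via remQuot.
StrongAdj : (A B : Graph) → Fin (n A * n B) → Fin (n A * n B) → Set
StrongAdj A B a b =
  let p = remQuot (n B) a ; q = remQuot (n B) b
      v = proj₁ p ; x = proj₂ p ; w = proj₁ q ; y = proj₂ q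
  in a ≢ b ×
     ((v ≡ w × Adj B x y) ⊎ (x ≡ y × Adj A v w) ⊎ (Adj A v w × Adj B x y))

StrongSym : (A B : Graph) → ∀ {a b} → StrongAdj A B a b → StrongAdj A B b a
StrongSym A B (a≢b , Data.Sum.inj₁ (e , xy)) =
  (λ e' → a≢b (Relation.Binary.PropositionalEquality.sym e')) ,
  Data.Sum.inj₁ (Relation.Binary.PropositionalEquality.sym e , Graph.sym B xy)
StrongSym A B (a≢b , Data.Sum.inj₂ (Data.Sum.inj₁ (e , vw))) =
  (λ e' → a≢b (Relation.Binary.PropositionalEquality.sym e')) ,
  Data.Sum.inj₂ (Data.Sum.inj₁ (Relation.Binary.PropositionalEquality.sym e , Graph.sym A vw))
StrongSym A B (a≢b , Data.Sum.inj₂ (Data.Sum.inj₂ (vw , xy))) =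
  (λ e' → a≢b (Relation.Binary.PropositionalEquality.sym e')) ,
  Data.Sum.inj₂ (Data.Sum.inj₂ (Graph.sym A vw , Graph.sym B xy))

_⊠_ : Graph → Graph → Graph
A ⊠ B = record
  { n = n A * n B
  ; Adj = StrongAdj A B
  ; sym = StrongSym A B
  ; irrefl = λ { (a≢a , _) → a≢a Relation.Binary.PropositionalEquality.refl }
  }

-- Order G ⊠ H lexicographically: first by the position of the G-coordinate in
-- an optimal ordering of G, then by the H-coordinate.  A reachability path in
-- G ⊠ H from (v, x) projects onto G as a walk from v all of whose vertices
-- but the last are ⪰ v; erasing its loops gives a path witnessing that its
-- endpoint w is (r, ⪯)-reachable from v in G.  Its projection onto H is a lazy
-- walk of length at most r from x.  So every reachable vertex lies in one of at
-- most c fibres {w} × B_r(x), and the ball B_r(x) has at most (Δ + 1)^r vertices.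
module Submission where

open import Defs hiding (sym)
open import Data.Nat using (ℕ; _≤_; _<_; _+_; _*_; _^_)
open import Data.Nat.Base using (zero; suc; z≤n; s≤s; >-nonZero)
import Data.Nat.Properties as ℕ
open import Data.Fin.Base as F using (Fin; fromℕ; fromℕ<; inject₁; lower₁; remQuot; toℕ)
import Data.Fin.Properties as FinP
import Data.Vec.Functional as Vector
open import Data.Product using (Σ; _×_; _,_; proj₁; proj₂; ∃-syntax)
open import Data.Product.Function.NonDependent.Propositional using (_×-↔_)
open import Data.Sum using (_⊎_; inj₁; inj₂)
open import Data.List using (List; []; _∷_; length; map)
open import Data.List.Properties using (length-map)
open import Data.List.Relation.Unary.All as All using (All; []; _∷_)
import Data.List.Relation.Unary.All.Properties as All
open import Data.List.Relation.Unary.AllPairs using ([]; _∷_)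
open import Data.List.Relation.Unary.Unique.Propositional using (Unique)
open import Data.List.Relation.Binary.Subset.Propositional using (_⊆_)
open import Data.List.Relation.Binary.Subset.Propositional.Properties using (xs⊆x∷xs; ∷⁺ʳ)
open import Data.Empty using (⊥-elim)
open import Function using (_∘_; id)
open import Function.Bundles using (Injection)
open import Function.Definitions using (Injective)
open import Function.Properties.Inverse using (↔-refl; ↔-sym; ↔-trans; ↔⇒↣)
open import Relation.Binary.PropositionalEquality
  using (_≡_; _≢_; refl; sym; trans; cong; cong₂; subst)
open import Relation.Nullary using (yes; no)

atMost-singleton : ∀ {m} (x : Fin m) → AtMost 1 (x ≡_)
atMost-singleton x []          _                  _                 = z≤n
atMost-singleton x (_ ∷ [])    _                  _                 = s≤s z≤n
atMost-singleton x (_ ∷ _ ∷ _) ((y≢z ∷ _) ∷ _) (refl ∷ refl ∷ _) = ⊥-elim (y≢z refl)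

atMost-injection : ∀ {m m′ k} {P : Fin m → Set} {Q : Fin m′ → Set} (g : Fin m → Fin m′) →
  (∀ {x y} → P x → P y → g x ≡ g y → x ≡ y) → (∀ {x} → P x → Q (g x)) →
  AtMost k Q → AtMost k P
atMost-injection {k = k} {P} g g-injective P⇒Q atMostQ xs xs! Pxs =
  subst (_≤ k) (length-map g xs)
    (atMostQ (map g xs) (map-unique xs! Pxs) (All.map⁺ (All.map P⇒Q Pxs)))
  where
  map-unique : ∀ {xs} → Unique xs → All P xs → Unique (map g xs)
  map-unique []            []         = []
  map-unique (x∉xs ∷ xs!) (px ∷ Pxs) =
    All.map⁺ (All.zipWith (λ (x≢y , py) gx≡gy → x≢y (g-injective px py gx≡gy)) (x∉xs , Pxs))
    ∷ map-unique xs! Pxs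

atMost-⊆ : ∀ {m k} {P Q : Fin m → Set} → (∀ {x} → P x → Q x) → AtMost k Q → AtMost k P
atMost-⊆ = atMost-injection id (λ _ _ → id)

record Partition {m} (A B : Fin m → Set) (xs : List (Fin m)) : Set where
  field
    left right   : List (Fin m)
    left⊆        : left ⊆ xs
    right⊆       : right ⊆ xs
    left-unique  : Unique left
    right-unique : Unique right
    all-left     : All A left
    all-right    : All B right
    length-sum   : length xs ≡ length left + length right

partition : ∀ {m} {A B : Fin m → Set} {xs} → Unique xs → All (λ x → A x ⊎ B x) xs →
  Partition A B xs
partition {xs = []} [] [] = record
  { left = [] ; right = [] ; left⊆ = id ; right⊆ = id ; left-unique = [] ; right-unique = []
  ; all-left = [] ; all-right = [] ; length-sum = refl }
partition {xs = x ∷ xs} (x∉xs ∷ xs!) (x∈A⊎B ∷ ABxs) with x∈A⊎B | partition xs! ABxs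
... | inj₁ ax | π = record
  { left = x ∷ left ; right = right ; left⊆ = ∷⁺ʳ x left⊆ ; right⊆ = xs⊆x∷xs xs x ∘ right⊆
  ; left-unique = All.anti-mono left⊆ x∉xs ∷ left-unique ; right-unique = right-unique
  ; all-left = ax ∷ all-left ; all-right = all-right ; length-sum = cong suc length-sum }
  where open Partition π
... | inj₂ bx | π = record
  { left = left ; right = x ∷ right ; left⊆ = xs⊆x∷xs xs x ∘ left⊆ ; right⊆ = ∷⁺ʳ x right⊆
  ; left-unique = left-unique ; right-unique = All.anti-mono right⊆ x∉xs ∷ right-unique
  ; all-left = all-left ; all-right = bx ∷ all-right
  ; length-sum = trans (cong suc length-sum) (sym (ℕ.+-suc (length left) (length right))) }
  where open Partition π

atMost-⊎ : ∀ {m a b} {A B : Fin m → Set} → AtMost a A → AtMost b B →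
  AtMost (a + b) (λ x → A x ⊎ B x)
atMost-⊎ {a = a} {b} atMostA atMostB xs xs! ABxs =
  subst (_≤ a + b) (sym length-sum)
    (ℕ.+-mono-≤ (atMostA left left-unique all-left) (atMostB right right-unique all-right))
  where open Partition (partition xs! ABxs)

atMost-remove : ∀ {m k} {Q : Fin m → Set} {x} → Q x → AtMost (suc k) Q →
  AtMost k (λ y → Q y × y ≢ x)
atMost-remove qx atMostQ ys ys! Qys = ℕ.≤-pred
  (atMostQ (_ ∷ ys) (All.map (λ (_ , y≢x) x≡y → y≢x (sym x≡y)) Qys ∷ ys!) (qx ∷ All.map proj₁ Qys))

-- The elements over the first index x met are counted by R x, the rest
-- recursively by Q without x.
atMost-Σ : ∀ {m m′} k₁ k₂ {Q : Fin m → Set} {R : Fin m → Fin m′ → Set} →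
  AtMost k₁ Q → (∀ x → Q x → AtMost k₂ (R x)) →
  AtMost (k₁ * k₂) (λ y → ∃[ x ] Q x × R x y)
atMost-Σ k₁ k₂ _ _ [] _ _ = z≤n
atMost-Σ zero k₂ atMostQ _ (_ ∷ _) _ ((x , qx , _) ∷ _)
  with () ← atMostQ (x ∷ []) ([] ∷ []) (qx ∷ [])
atMost-Σ (suc k₁) k₂ {Q} {R} atMostQ atMostR ys@(_ ∷ _) ys! QRys@((x , qx , _) ∷ _) =
  atMost-⊆ separate
    (atMost-⊎ (atMostR x qx)
      (atMost-Σ k₁ k₂ (atMost-remove qx atMostQ) (λ x′ q → atMostR x′ (proj₁ q))))
    ys ys! QRys
  where
  separate : ∀ {y} → ∃[ x′ ] Q x′ × R x′ y → R x y ⊎ ∃[ x′ ] (Q x′ × x′ ≢ x) × R x′ y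
  separate (x′ , qx′ , r) with x′ FinP.≟ x
  ... | yes refl  = inj₁ r
  ... | no  x′≢x = inj₂ (x′ , (qx′ , x′≢x) , r)

atMost-fibre : ∀ {m m′ k} {P : Fin m′ → Set} (x : Fin m) → AtMost k P →
  AtMost k (λ e → proj₁ (remQuot {m} m′ e) ≡ x × P (proj₂ (remQuot {m} m′ e)))
atMost-fibre {m} {m′} {P = P} x = atMost-injection (proj₂ ∘ remQuot {m} m′) same-fibre proj₂
  where
  same-fibre : ∀ {e₁ e₂} → proj₁ (remQuot {m} m′ e₁) ≡ x × P (proj₂ (remQuot {m} m′ e₁)) →
    proj₁ (remQuot {m} m′ e₂) ≡ x × P (proj₂ (remQuot {m} m′ e₂)) →
    proj₂ (remQuot {m} m′ e₁) ≡ proj₂ (remQuot {m} m′ e₂) → e₁ ≡ e₂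
  same-fibre (refl , _) (e₂≡x , _) eq =
    Injection.injective (↔⇒↣ (FinP.*↔× {m} {m′})) (cong₂ _,_ (sym e₂≡x) eq)

LazyStep : (G : Graph) → Fin (n G) → Fin (n G) → Set
LazyStep G x y = x ≡ y ⊎ Adj G x y

LazyWalk : (G : Graph) (K : ℕ) → (Fin (suc K) → Fin (n G)) → Set
LazyWalk G K f = (i : Fin K) → LazyStep G (f (inject₁ i)) (f (F.suc i))

Ball : (G : Graph) → Fin (n G) → ℕ → Fin (n G) → Set
Ball G x zero    y = x ≡ y
Ball G x (suc r) y = ∃[ z ] LazyStep G x z × Ball G z r y

ball-refl : ∀ {G} x r → Ball G x r x
ball-refl x zero    = refl
ball-refl x (suc r) = x , inj₁ refl , ball-refl x r

ball-mono : ∀ {G x y k r} → k ≤ r → Ball G x k y → Ball G x r y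
ball-mono {r = r} z≤n     refl          = ball-refl _ r
ball-mono         (s≤s k≤r) (z , s , b) = z , s , ball-mono k≤r b

ball-atMost : ∀ {G Δ} → MaxDegreeAtMost G Δ → ∀ x r → AtMost ((1 + Δ) ^ r) (Ball G x r)
ball-atMost         deg x zero    = atMost-singleton x
ball-atMost {Δ = Δ} deg x (suc r) =
  atMost-Σ (1 + Δ) ((1 + Δ) ^ r) (atMost-⊎ (atMost-singleton x) (deg x))
    (λ z _ → ball-atMost deg z r)

lazyWalk⇒ball : ∀ {G K} f → LazyWalk G K f → Ball G (f F.zero) K (f (fromℕ K))
lazyWalk⇒ball {K = zero}  f _ = refl
lazyWalk⇒ball {K = suc K} f w =
  f (F.suc F.zero) , w F.zero , lazyWalk⇒ball (f ∘ F.suc) (w ∘ F.suc)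

path-point : ∀ {G} → Fin (n G) → Path G 0
path-point v = record { vtx = λ _ → v ; inj = λ { {F.zero} {F.zero} _ → refl } ; step = λ () }

path-tail : ∀ {G m} → Path G (suc m) → Path G m
path-tail p = record
  { vtx = vtx p ∘ F.suc ; inj = FinP.suc-injective ∘ inj p ; step = step p ∘ F.suc }

path-cons : ∀ {G m} (u : Fin (n G)) (p : Path G m) → Adj G u (vtx p F.zero) →
  (∀ i → vtx p i ≢ u) → Path G (suc m)
path-cons u p u~p₀ fresh = record
  { vtx = u Vector.∷ vtx p ; inj = injective ; step = λ { F.zero → u~p₀ ; (F.suc i) → step p i } }
  where
  injective : Injective _≡_ _≡_ (u Vector.∷ vtx p)
  injective {F.zero}  {F.zero}  _ = refl
  injective {F.zero}  {F.suc j} e = ⊥-elim (fresh j (sym e))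
  injective {F.suc i} {F.zero}  e = ⊥-elim (fresh i e)
  injective {F.suc i} {F.suc j} e = cong F.suc (inj p e)

record GuardedPath (G : Graph) (P : Fin (n G) → Set) (m : ℕ) (s t : Fin (n G)) : Set where
  field
    path    : Path G m
    source  : vtx path F.zero ≡ s
    target  : vtx path (fromℕ m) ≡ t
    guarded : (i : Fin m) → P (vtx path (inject₁ i))
open GuardedPath

guarded-point : ∀ {G P} v → GuardedPath G P 0 v v
guarded-point v = record { path = path-point v ; source = refl ; target = refl ; guarded = λ () }

guarded-tail : ∀ {G P m s t} (γ : GuardedPath G P (suc m) s t) →
  GuardedPath G P m (vtx (path γ) (F.suc F.zero)) t
guarded-tail γ = record
  { path = path-tail (path γ) ; source = refl ; target = target γ ; guarded = guarded γ ∘ F.suc }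

guarded-drop : ∀ {G P m s t} (γ : GuardedPath G P m s t) (i : Fin (suc m)) →
  ∃[ m′ ] m′ ≤ m × GuardedPath G P m′ (vtx (path γ) i) t
guarded-drop {m = m}     γ F.zero    = m , ℕ.≤-refl , record
  { path = path γ ; source = refl ; target = target γ ; guarded = guarded γ }
guarded-drop {m = suc m} γ (F.suc i) with guarded-drop (guarded-tail γ) i
... | m′ , m′≤m , γ′ = m′ , ℕ.m≤n⇒m≤1+n m′≤m , γ′

guarded-cons : ∀ {G P m s t u} → P u → Adj G u s → (γ : GuardedPath G P m s t) →
  (∀ i → vtx (path γ) i ≢ u) → GuardedPath G P (suc m) u t
guarded-cons {G} {u = u} pu u~s γ fresh = record
  { path    = path-cons u (path γ) (subst (Adj G u) (sym (source γ)) u~s) fresh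
  ; source  = refl
  ; target  = target γ
  ; guarded = λ { F.zero → pu ; (F.suc i) → guarded γ i } }

-- Prepending a vertex that already lies on the path closes a loop, which is cut off.
guarded-prepend : ∀ {G P m s t u} → P u → LazyStep G u s → GuardedPath G P m s t →
  ∃[ m′ ] m′ ≤ suc m × GuardedPath G P m′ u t
guarded-prepend {m = m} _ (inj₁ refl) γ = m , ℕ.n≤1+n m , γ
guarded-prepend {u = u} pu (inj₂ u~s) γ with FinP.any? (λ i → vtx (path γ) i FinP.≟ u)
... | yes (i , refl) with guarded-drop γ i
...   | m′ , m′≤m , γ′ = m′ , ℕ.m≤n⇒m≤1+n m′≤m , γ′
guarded-prepend {m = m} pu (inj₂ u~s) γ | no u∉γ =
  suc m , ℕ.≤-refl , guarded-cons pu u~s γ (λ i vᵢ≡u → u∉γ (i , vᵢ≡u))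

lazyWalk⇒guardedPath : ∀ {G P K} f → LazyWalk G K f → (∀ i → P (f (inject₁ i))) →
  ∃[ m ] m ≤ K × GuardedPath G P m (f F.zero) (f (fromℕ K))
lazyWalk⇒guardedPath {K = zero} f _ _ = 0 , z≤n , guarded-point (f F.zero)
lazyWalk⇒guardedPath {K = suc K} f w Pf
  with lazyWalk⇒guardedPath (f ∘ F.suc) (w ∘ F.suc) (Pf ∘ F.suc)
... | m , m≤K , γ with guarded-prepend (Pf F.zero) (w F.zero) γ
...   | m′ , m′≤1+m , γ′ = m′ , ℕ.≤-trans m′≤1+m (s≤s m≤K) , γ′

rank-injective : ∀ G (σ : Ordering G) {x y} → rank G σ x ≡ rank G σ y → x ≡ y
rank-injective G σ = Injection.injective (↔⇒↣ σ)

guardedPath⇒reachable : ∀ {G σ r m v w} → m ≤ r →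
  GuardedPath G (λ x → rank G σ v F.≤ rank G σ x) m v w → rank G σ w F.≤ rank G σ v →
  Reachable G σ r v w
guardedPath⇒reachable {G} {σ} {m = m} {v} m≤r γ w⪯v =
  m , m≤r , path γ , source γ , target γ , w⪯v , interior
  where
  interior : (i : Fin (suc m)) → i ≢ F.zero → i ≢ fromℕ m →
    rank G σ v F.< rank G σ (vtx (path γ) i)
  interior i i≢0 i≢m = FinP.≤∧≢⇒< v⪯vᵢ
    (λ e → i≢0 (sym (inj (path γ) (trans (source γ) (rank-injective G σ e)))))
    where
    m≢i : m ≢ toℕ i
    m≢i m≡i = i≢m (FinP.toℕ-injective (trans (sym m≡i) (sym (FinP.toℕ-fromℕ m))))
    v⪯vᵢ : rank G σ v F.≤ rank G σ (vtx (path γ) i)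
    v⪯vᵢ = subst (λ j → rank G σ v F.≤ rank G σ (vtx (path γ) j))
      (FinP.inject₁-lower₁ i m≢i) (guarded γ (lower₁ i m≢i))

colAtMost⇒positive : ∀ {G r k} → 1 ≤ n G → ColAtMost G r k → 1 ≤ k
colAtMost⇒positive 1≤n (σ , col) =
  col v (v ∷ []) ([] ∷ []) (guardedPath⇒reachable {σ = σ} z≤n (guarded-point v) FinP.≤-refl ∷ [])
  where v = fromℕ< 1≤n

module StrongProduct (G H : Graph) where

  πG : Fin (n (G ⊠ H)) → Fin (n G)
  πG e = proj₁ (remQuot {n G} (n H) e)

  πH : Fin (n (G ⊠ H)) → Fin (n H)
  πH e = proj₂ (remQuot {n G} (n H) e)

  adj⇒lazySteps : ∀ {a b} → Adj (G ⊠ H) a b →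
    LazyStep G (πG a) (πG b) × LazyStep H (πH a) (πH b)
  adj⇒lazySteps (_ , inj₁ (v≡w , x~y))         = inj₁ v≡w , inj₂ x~y
  adj⇒lazySteps (_ , inj₂ (inj₁ (x≡y , v~w))) = inj₂ v~w , inj₁ x≡y
  adj⇒lazySteps (_ , inj₂ (inj₂ (v~w , x~y))) = inj₂ v~w , inj₂ x~y

  lexOrdering : Ordering G → Ordering (G ⊠ H)
  lexOrdering σ = ↔-trans FinP.*↔× (↔-trans (σ ×-↔ ↔-refl) (↔-sym FinP.*↔×))

  lex-proj-mono : ∀ σ {a b} → rank (G ⊠ H) (lexOrdering σ) a F.≤ rank (G ⊠ H) (lexOrdering σ) b →
    rank G σ (πG a) F.≤ rank G σ (πG b)
  lex-proj-mono σ a⪯b = ℕ.≮⇒≥ (λ b≺a → ℕ.<⇒≱ (FinP.combine-monoˡ-< _ _ b≺a) a⪯b)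

  reachable-⊠ : ∀ σ {r a e} → Reachable (G ⊠ H) (lexOrdering σ) r a e →
    Reachable G σ r (πG a) (πG e) × Ball H (πH a) r (πH e)
  reachable-⊠ σ (r′ , r′≤r , p , refl , refl , e⪯a , interior) =
    reachableG , ball-mono r′≤r (lazyWalk⇒ball (πH ∘ vtx p) (proj₂ ∘ steps))
    where
    steps : (i : Fin r′) → LazyStep G (πG (vtx p (inject₁ i))) (πG (vtx p (F.suc i)))
                         × LazyStep H (πH (vtx p (inject₁ i))) (πH (vtx p (F.suc i)))
    steps i = adj⇒lazySteps (step p i)
    above : (i : Fin r′) → rank G σ (πG (vtx p F.zero)) F.≤ rank G σ (πG (vtx p (inject₁ i)))
    above F.zero    = FinP.≤-refl
    above (F.suc i) = lex-proj-mono σ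
      (ℕ.<⇒≤ (interior (F.suc (inject₁ i)) (λ ()) (FinP.fromℕ≢inject₁ ∘ sym)))
    reachableG : Reachable G σ _ (πG (vtx p F.zero)) (πG (vtx p (fromℕ r′)))
    reachableG with lazyWalk⇒guardedPath (πG ∘ vtx p) (proj₁ ∘ steps) above
    ... | m , m≤r′ , γ =
      guardedPath⇒reachable {σ = σ} (ℕ.≤-trans m≤r′ r′≤r) γ (lex-proj-mono σ e⪯a)

mainTheorem9 : (r c Δ : ℕ) (G H : Graph) → 1 ≤ r → 1 ≤ n G →
    ColAtMost G r c → MaxDegreeAtMost H Δ →
    Σ ℕ λ k → k < c * (Δ + 2) ^ r × ColAtMost (G ⊠ H) r k
mainTheorem9 r c Δ G H 1≤r 1≤nG colG@(σ , reachG) degH =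
  c * (1 + Δ) ^ r , growth , lexOrdering σ , reachable-count
  where
  open StrongProduct G H
  reachable-count : ∀ a → AtMost (c * (1 + Δ) ^ r) (Reachable (G ⊠ H) (lexOrdering σ) r a)
  reachable-count a =
    atMost-⊆ (λ re → _ , proj₁ (reachable-⊠ σ re) , refl , proj₂ (reachable-⊠ σ re))
      (atMost-Σ c ((1 + Δ) ^ r) (reachG (πG a))
        (λ w _ → atMost-fibre w (ball-atMost degH (πH a) r)))
  growth : c * (1 + Δ) ^ r < c * (Δ + 2) ^ r
  growth = ℕ.*-monoʳ-< c {{>-nonZero (colAtMost⇒positive 1≤nG colG)}}
    (ℕ.^-monoˡ-< r {{>-nonZero 1≤r}} (ℕ.≤-reflexive (sym (ℕ.+-comm Δ 2))))
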